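{- Let $n>10$ be an integer. Then $\rho(T(n))\le\rho(T(n-5))+\rho(T^5(n))$ and $\rho(T(n))\le\rho(T(n-10))+\rho(T^{10}(n))$.
   Context: $T(n)$ is the subgraph of the infinite integer grid (vertex set $\mathbb{Z}^2$, $(x,y)\sim(x',y')$ iff $|x-x'|+|y-y'|=1$) induced by $\{(x,y): 1\le x\le y\le n\}$. For a positive integer $\ell\le n$, $T^{\ell}(n)$ is the subgraph of $T(n)$ induced by the vertices $(x,y)$ of $T(n)$ with $n-\ell+1\le y\le n$. A packing set of a graph $G$ is a set $S\subseteq V(G)$ such that any two distinct $u,v\in S$ satisfy $d_G(u,v)\ge 3$ ($d_G$ the distance in $G$); $\rho(G)$ is the maximum size of a packing set of $G$. -}

module Defs where

open import Data.Nat using (ℕ; zero; suc; _+_; _∸_; _≤_; ∣_-_∣)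
open import Data.Product using (_×_; _,_; Σ)
open import Data.List using (List; length)
open import Data.List.Relation.Unary.All using (All)
open import Data.List.Relation.Unary.Unique.Propositional using (Unique)
open import Data.List.Membership.Propositional using (_∈_)
open import Relation.Binary.PropositionalEquality using (_≡_; _≢_)

-- Grid points (all relevant vertices have positive coordinates).
Point : Set
Point = ℕ × ℕ

-- A vertex set (the induced subgraph of the grid it spans).
VSet : Set₁
VSet = Point → Set

Adj : Point → Point → Set
Adj (x , y) (x' , y') = ∣ x - x' ∣ + ∣ y - y' ∣ ≡ 1

T : ℕ → VSet
T n (x , y) = (1 ≤ x) × (x ≤ y) × (y ≤ n)

T^ : ℕ → ℕ → VSet
T^ ℓ n (x , y) = T n (x , y) × (n ∸ ℓ + 1 ≤ y)

data Walk (V : VSet) : Point → Point → ℕ → Set where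
  here : ∀ {u} → V u → Walk V u u 0
  step : ∀ {u w v k} → V u → Adj u w → Walk V w v k → Walk V u v (suc k)

-- d_G(u,v) ≥ 3 : every walk from u to v in G has length ≥ 3
-- (includes the case d_G(u,v) = ∞).
DistGe3 : VSet → Point → Point → Set
DistGe3 V u v = ∀ k → Walk V u v k → 3 ≤ k

IsPacking : VSet → List Point → Set
IsPacking V S =
  All V S × Unique S ×
  (∀ u v → u ∈ S → v ∈ S → u ≢ v → DistGe3 V u v)

IsPackingNumber : VSet → ℕ → Set
IsPackingNumber V m =
  Σ (List Point) (λ S → IsPacking V S × length S ≡ m) ×
  (∀ S → IsPacking V S → length S ≤ m)

module Submission where

-- Distances can only grow when passing to an induced subgraph:
-- a walk inside a smaller vertex set is also a walk inside a larger one.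
-- Hence, if a vertex set V is covered by two induced subgraphs W₁ and W₂,
-- cut out of V by a decidable predicate P and its complement, then any
-- packing S of V splits into the packing (S ∩ P) of W₁ and the packing
-- (S ∖ P) of W₂, and so ρ(V) ≤ ρ(W₁) + ρ(W₂).
--
-- For the triangle T(n) we cut at the row y = n - ℓ: the rows y ≤ n - ℓ
-- form exactly T(n - ℓ), the remaining rows form the strip T^ℓ(n).  This
-- gives ρ(T(n)) ≤ ρ(T(n - ℓ)) + ρ(T^ℓ(n)) for every ℓ and n, and the
-- corollary is the instances ℓ = 5 and ℓ = 10.

open import Defs
open import Data.Nat using (ℕ; _+_; _∸_; _≤_; _<_; _≤?_)
open import Data.Nat.Properties using (≤-trans; m∸n≤m; ≰⇒>; +-mono-≤; +-comm)
open import Data.Product using (_×_; _,_; proj₁)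
open import Data.List using (List; length; filter)
import Data.List.Relation.Unary.All as All
import Data.List.Relation.Unary.All.Properties as All
import Data.List.Relation.Unary.Unique.Propositional.Properties as Unique
open import Data.List.Membership.Propositional.Properties using (∈-filter⁻)
open import Data.List.Relation.Ternary.Interleaving.Properties using (interleave-length)
open import Data.List.Relation.Ternary.Interleaving.Propositional.Properties using (filter⁺)
open import Relation.Nullary using (¬?)
open import Relation.Unary using (Pred; Decidable; _⊆_; _∩_; ∁)
open import Relation.Binary.PropositionalEquality using (_≡_; refl; sym; subst)
open import Function using (_∘_)
open import Level using (0ℓ)

walk-mono : ∀ {W V : VSet} → W ⊆ V → ∀ {u v k} → Walk W u v k → Walk V u v k
walk-mono W⊆V (here u∈W)          = here (W⊆V u∈W)
walk-mono W⊆V (step u∈W u~w walk) = step (W⊆V u∈W) u~w (walk-mono W⊆V walk)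

distGe3-mono : ∀ {W V : VSet} → W ⊆ V → ∀ {u v} → DistGe3 V u v → DistGe3 W u v
distGe3-mono W⊆V far k walk = far k (walk-mono W⊆V walk)

packing-restrict : ∀ {V W : VSet} {P : Pred Point 0ℓ} (P? : Decidable P) →
  W ⊆ V → V ∩ P ⊆ W → ∀ S → IsPacking V S → IsPacking W (filter P? S)
packing-restrict P? W⊆V V∩P⊆W S (S⊆V , unique , far) =
  All.zipWith V∩P⊆W (All.filter⁺ P? S⊆V , All.all-filter P? S) ,
  Unique.filter⁺ P? unique ,
  λ u v u∈ v∈ u≢v →
    distGe3-mono W⊆V (far u v (proj₁ (∈-filter⁻ P? u∈)) (proj₁ (∈-filter⁻ P? v∈)) u≢v)

length-split : ∀ {P : Pred Point 0ℓ} (P? : Decidable P) (S : List Point) →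
  length S ≡ length (filter P? S) + length (filter (¬? ∘ P?) S)
length-split P? S = interleave-length (filter⁺ P? S)

packingNumber-split : ∀ {V W₁ W₂ : VSet} {P : Pred Point 0ℓ} (P? : Decidable P) →
  W₁ ⊆ V → V ∩ P ⊆ W₁ → W₂ ⊆ V → V ∩ ∁ P ⊆ W₂ →
  ∀ a b c → IsPackingNumber V a → IsPackingNumber W₁ b → IsPackingNumber W₂ c →
  a ≤ b + c
packingNumber-split P? W₁⊆V V∩P⊆W₁ W₂⊆V V∖P⊆W₂ a b c
  ((S , packing , refl) , _) (_ , ρW₁-max) (_ , ρW₂-max) =
  subst (_≤ b + c) (sym (length-split P? S))
    (+-mono-≤ (ρW₁-max _ (packing-restrict P? W₁⊆V V∩P⊆W₁ S packing))
              (ρW₂-max _ (packing-restrict (¬? ∘ P?) W₂⊆V V∖P⊆W₂ S packing)))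

LowRows : ℕ → ℕ → Pred Point 0ℓ
LowRows ℓ n (_ , y) = y ≤ n ∸ ℓ

lowRows? : ∀ ℓ n → Decidable (LowRows ℓ n)
lowRows? ℓ n (_ , y) = y ≤? n ∸ ℓ

T-shrink⊆T : ∀ ℓ n → T (n ∸ ℓ) ⊆ T n
T-shrink⊆T ℓ n (1≤x , x≤y , y≤n∸ℓ) = 1≤x , x≤y , ≤-trans y≤n∸ℓ (m∸n≤m n ℓ)

T∩low⊆T-shrink : ∀ ℓ n → T n ∩ LowRows ℓ n ⊆ T (n ∸ ℓ)
T∩low⊆T-shrink ℓ n ((1≤x , x≤y , _) , y≤n∸ℓ) = 1≤x , x≤y , y≤n∸ℓ

T^⊆T : ∀ ℓ n → T^ ℓ n ⊆ T n
T^⊆T ℓ n (p∈T , _) = p∈T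

T∖low⊆T^ : ∀ ℓ n → T n ∩ ∁ (LowRows ℓ n) ⊆ T^ ℓ n
T∖low⊆T^ ℓ n {_ , y} (p∈T , y≰n∸ℓ) = p∈T , subst (_≤ y) (+-comm 1 (n ∸ ℓ)) (≰⇒> y≰n∸ℓ)

T-packingNumber-split : ∀ ℓ n a b c →
  IsPackingNumber (T n) a → IsPackingNumber (T (n ∸ ℓ)) b →
  IsPackingNumber (T^ ℓ n) c → a ≤ b + c
T-packingNumber-split ℓ n =
  packingNumber-split (lowRows? ℓ n)
    (T-shrink⊆T ℓ n) (T∩low⊆T-shrink ℓ n) (T^⊆T ℓ n) (T∖low⊆T^ ℓ n)

corollary3p2 : ∀ (n : ℕ) → 10 < n →
    (∀ a b c → IsPackingNumber (T n) a → IsPackingNumber (T (n ∸ 5)) b →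
      IsPackingNumber (T^ 5 n) c → a ≤ b + c)
    × (∀ a b c → IsPackingNumber (T n) a → IsPackingNumber (T (n ∸ 10)) b →
      IsPackingNumber (T^ 10 n) c → a ≤ b + c)
corollary3p2 n _ = T-packingNumber-split 5 n , T-packingNumber-split 10 n
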